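{- Let $G$ be a finite simple graph and $u,v\in V(G)$ with $u\ne v$. Define $\mathcal{M}_v=\{\{\sigma\setminus\{v\},\sigma\cup\{v\}\}\mid \sigma\setminus\{v\},\sigma\cup\{v\}\in\Delta_2^t(G)\}$ and $\mathcal{C}=\{\sigma\in\Delta_2^t(G)\mid \sigma \text{ lies in no pair of } \mathcal{M}_v\}$. Then for every $\sigma\in\Delta_2^t(G)$: (i) $\sigma\in\mathcal{C}$ if and only if $\sigma\cup\{v\}\notin\Delta_2^t(G)$; equivalently, $\sigma\in\mathcal{C}$ iff every disconnected $2$-set in $\sigma^c$ contains $v$. (ii) If $\sigma\in\mathcal{C}$ and $\sigma\cup\{u\}\in\Delta_2^t(G)$, then $\sigma\cup\{u\}\in\mathcal{C}$. (iii) If $\sigma\in\mathcal{C}$ and $u\sim w$ for all $w\in(\sigma\cup\{v\})^c$, then $\sigma\setminus\{u\}\in\mathcal{C}$.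
   Context: For a graph $G$, the total $2$-cut complex $\Delta_2^t(G)$ is the simplicial complex on $V(G)$ whose facets are the $\sigma\subseteq V(G)$ with $|\sigma|=|V(G)|-2$ such that $G[V(G)\setminus\sigma]$ has no edge; equivalently, $\sigma\in\Delta_2^t(G)$ iff $\sigma^c:=V(G)\setminus\sigma$ contains two distinct non-adjacent vertices. A disconnected $2$-set in a set $A\subseteq V(G)$ is a subset $\{a,b\}\subseteq A$ with $a\ne b$ and $a\nsim b$. $u\sim w$ denotes adjacency. -}

module Defs where

open import Data.Nat using (ℕ)
open import Data.Fin using (Fin)
open import Data.Fin.Subset using (Subset; _∈_; _∉_; _∪_; _-_; ⁅_⁆)
open import Data.Product using (Σ; ∃; _×_)
open import Data.Sum using (_⊎_)
open import Relation.Nullary using (¬_)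
open import Relation.Binary.PropositionalEquality using (_≡_; _≢_)

record Graph (n : ℕ) : Set₁ where
  field
    Adj   : Fin n → Fin n → Set
    sym   : ∀ {x y} → Adj x y → Adj y x
    irrefl : ∀ {x} → ¬ Adj x x
open Graph public

DisconnectedPairOutside : ∀ {n} → Graph n → Subset n → Fin n → Fin n → Set
DisconnectedPairOutside G σ a b = a ≢ b × a ∉ σ × b ∉ σ × ¬ Adj G a b

InΔ2t : ∀ {n} → Graph n → Subset n → Set
InΔ2t G σ = ∃ λ a → ∃ λ b → DisconnectedPairOutside G σ a b

InSomePairOfMv : ∀ {n} → Graph n → Fin n → Subset n → Set
InSomePairOfMv G v σ =
  ∃ λ τ → InΔ2t G (τ - v) × InΔ2t G (τ ∪ ⁅ v ⁆) × (σ ≡ τ - v ⊎ σ ≡ τ ∪ ⁅ v ⁆)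

InC : ∀ {n} → Graph n → Fin n → Subset n → Set
InC G v σ = InΔ2t G σ × ¬ InSomePairOfMv G v σ

-- Adding v to σ changes σᶜ only at v, so σ lies in a pair of 𝓜_v iff σ ∪ {v} ∈ Δ₂ᵗ(G) (the pair
-- {σ ∖ {v}, σ ∪ {v}} itself witnesses this); thus σ ∈ 𝓒 iff σ ∪ {v} ∉ Δ₂ᵗ(G), i.e. iff every
-- disconnected 2-set of σᶜ contains v. As Δ₂ᵗ(G) is closed under subsets, 𝓒 is closed upwards
-- inside Δ₂ᵗ(G), which gives (ii). For (iii), a disconnected 2-set of (σ ∖ {u})ᶜ through u
-- contains v, since u is adjacent to every other vertex outside σ ∪ {v}.
module Submission where

open import Defs
open import Data.Nat using (ℕ)
open import Data.Fin using (Fin; _≟_)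
open import Data.Fin.Subset using (Subset; _∉_; _∪_; _-_; ⁅_⁆; _⊆_)
open import Data.Fin.Subset.Properties
  using (x∈p∪q⁻; x∈p∪q⁺; p⊆p∪q; q⊆p∪q; x∈⁅x⁆; x∈⁅y⁆⇒x≡y; x≢y⇒x∉⁅y⁆; ⊆-refl; ⊆-trans; ⊆-antisym; p─q⊆p; x∈p∧x≢y⇒x∈p-y; _∈?_)
open import Data.Product using (_×_; _,_)
open import Data.Sum using (_⊎_; inj₁; inj₂; [_,_])
open import Data.Empty using (⊥-elim)
open import Function using (_∘_)
open import Function.Bundles using (_⇔_; mk⇔; Equivalence)
open import Function.Properties.Equivalence using () renaming (trans to ⇔-trans)
open import Relation.Nullary using (¬_; yes; no)
open import Relation.Nullary.Decidable using (decidable-stable)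
open import Relation.Binary.PropositionalEquality using (_≡_; _≢_; refl)

private
  variable
    n : ℕ
    p q r : Subset n
    x y : Fin n

∪-least : p ⊆ r → q ⊆ r → p ∪ q ⊆ r
∪-least {p = p} {q = q} p⊆r q⊆r x∈p∪q = [ p⊆r , q⊆r ] (x∈p∪q⁻ p q x∈p∪q)

∪-monoˡ-⊆ : p ⊆ q → p ∪ r ⊆ q ∪ r
∪-monoˡ-⊆ {q = q} {r = r} p⊆q = ∪-least (⊆-trans p⊆q (p⊆p∪q r)) (q⊆p∪q q r)

x∉p∪⁅y⁆⁺ : x ∉ p → x ≢ y → x ∉ p ∪ ⁅ y ⁆
x∉p∪⁅y⁆⁺ {p = p} {y = y} x∉p x≢y x∈ = [ x∉p , x≢y⇒x∉⁅y⁆ x≢y ] (x∈p∪q⁻ p ⁅ y ⁆ x∈)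

x∉p∪q⇒x∉p : x ∉ p ∪ q → x ∉ p
x∉p∪q⇒x∉p x∉ x∈p = x∉ (x∈p∪q⁺ (inj₁ x∈p))

x∉p∪⁅y⁆⇒x≢y : x ∉ p ∪ ⁅ y ⁆ → x ≢ y
x∉p∪⁅y⁆⇒x≢y {y = y} x∉ refl = x∉ (x∈p∪q⁺ (inj₂ (x∈⁅x⁆ y)))

x∉p-y⇒x∉p : x ∉ p - y → x ≢ y → x ∉ p
x∉p-y⇒x∉p x∉ x≢y x∈p = x∉ (x∈p∧x≢y⇒x∈p-y x∈p x≢y)

p≡p-x⊎p≡p∪⁅x⁆ : ∀ (p : Subset n) x → p ≡ p - x ⊎ p ≡ p ∪ ⁅ x ⁆
p≡p-x⊎p≡p∪⁅x⁆ p x with x ∈? p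
... | yes x∈p = inj₂ (⊆-antisym (p⊆p∪q ⁅ x ⁆) (∪-least ⊆-refl ⁅x⁆⊆p))
  where
  ⁅x⁆⊆p : ⁅ x ⁆ ⊆ p
  ⁅x⁆⊆p y∈⁅x⁆ with x∈⁅y⁆⇒x≡y x y∈⁅x⁆
  ... | refl = x∈p
... | no x∉p = inj₁ (⊆-antisym (λ y∈p → x∈p∧x≢y⇒x∈p-y y∈p λ { refl → x∉p y∈p }) (p─q⊆p p ⁅ x ⁆))

EveryDisconnectedPairMeets : Graph n → Subset n → Fin n → Set
EveryDisconnectedPairMeets G σ v = ∀ a b → DisconnectedPairOutside G σ a b → a ≡ v ⊎ b ≡ v

module _ {n} (G : Graph n) where

  InΔ2t-downClosed : p ⊆ q → InΔ2t G q → InΔ2t G p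
  InΔ2t-downClosed p⊆q (a , b , a≢b , a∉q , b∉q , a≁b) =
    a , b , a≢b , (λ a∈p → a∉q (p⊆q a∈p)) , (λ b∈p → b∉q (p⊆q b∈p)) , a≁b

  inSomePairOfMv⇔ : ∀ v {σ} → InΔ2t G σ → InSomePairOfMv G v σ ⇔ InΔ2t G (σ ∪ ⁅ v ⁆)
  inSomePairOfMv⇔ v {σ} σ∈Δ = mk⇔ to from
    where
    to : InSomePairOfMv G v σ → InΔ2t G (σ ∪ ⁅ v ⁆)
    to (τ , _ , τ∪v∈Δ , inj₁ refl) =
      InΔ2t-downClosed (∪-monoˡ-⊆ (p─q⊆p τ ⁅ v ⁆)) τ∪v∈Δ
    to (τ , _ , τ∪v∈Δ , inj₂ refl) =
      InΔ2t-downClosed (∪-least ⊆-refl (q⊆p∪q τ ⁅ v ⁆)) τ∪v∈Δ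
    from : InΔ2t G (σ ∪ ⁅ v ⁆) → InSomePairOfMv G v σ
    from σ∪v∈Δ = σ , InΔ2t-downClosed (p─q⊆p σ ⁅ v ⁆) σ∈Δ , σ∪v∈Δ , p≡p-x⊎p≡p∪⁅x⁆ σ v

  inC⇔ : ∀ v {σ} → InΔ2t G σ → InC G v σ ⇔ (¬ InΔ2t G (σ ∪ ⁅ v ⁆))
  inC⇔ v σ∈Δ = mk⇔ (λ (_ , ¬pair) → ¬pair ∘ from) (λ ¬σ∪v∈Δ → σ∈Δ , ¬σ∪v∈Δ ∘ to)
    where open Equivalence (inSomePairOfMv⇔ v σ∈Δ)

  ¬InΔ2t-∪⁅⁆⇔ : ∀ v σ → (¬ InΔ2t G (σ ∪ ⁅ v ⁆)) ⇔ EveryDisconnectedPairMeets G σ v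
  ¬InΔ2t-∪⁅⁆⇔ v σ = mk⇔ to from
    where
    to : ¬ InΔ2t G (σ ∪ ⁅ v ⁆) → EveryDisconnectedPairMeets G σ v
    to ¬σ∪v∈Δ a b (a≢b , a∉σ , b∉σ , a≁b) with a ≟ v | b ≟ v
    ... | yes a≡v | _       = inj₁ a≡v
    ... | no _    | yes b≡v = inj₂ b≡v
    ... | no a≢v  | no b≢v  =
      ⊥-elim (¬σ∪v∈Δ (a , b , a≢b , x∉p∪⁅y⁆⁺ a∉σ a≢v , x∉p∪⁅y⁆⁺ b∉σ b≢v , a≁b))
    from : EveryDisconnectedPairMeets G σ v → ¬ InΔ2t G (σ ∪ ⁅ v ⁆)
    from meets (a , b , a≢b , a∉σ∪v , b∉σ∪v , a≁b) =
      [ x∉p∪⁅y⁆⇒x≢y a∉σ∪v , x∉p∪⁅y⁆⇒x≢y b∉σ∪v ]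
        (meets a b (a≢b , x∉p∪q⇒x∉p a∉σ∪v , x∉p∪q⇒x∉p b∉σ∪v , a≁b))

  inC⇔everyDisconnectedPairMeets : ∀ v {σ} → InΔ2t G σ → InC G v σ ⇔ EveryDisconnectedPairMeets G σ v
  inC⇔everyDisconnectedPairMeets v {σ} σ∈Δ = ⇔-trans (inC⇔ v σ∈Δ) (¬InΔ2t-∪⁅⁆⇔ v σ)

  inC-upClosed : ∀ v {σ τ} → σ ⊆ τ → InΔ2t G σ → InC G v σ → InΔ2t G τ → InC G v τ
  inC-upClosed v σ⊆τ σ∈Δ σ∈C τ∈Δ =
    Equivalence.from (inC⇔ v τ∈Δ)
      (Equivalence.to (inC⇔ v σ∈Δ) σ∈C ∘ InΔ2t-downClosed (∪-monoˡ-⊆ σ⊆τ))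

  inC-minus : ∀ {u v σ} → (∀ w → w ∉ σ ∪ ⁅ v ⁆ → Adj G u w) → InΔ2t G σ → InC G v σ → InC G v (σ - u)
  inC-minus {u} {v} {σ} u-dominates σ∈Δ σ∈C =
    Equivalence.from (inC⇔everyDisconnectedPairMeets v σ-u∈Δ) meets
    where
    σ-u∈Δ : InΔ2t G (σ - u)
    σ-u∈Δ = InΔ2t-downClosed (p─q⊆p σ ⁅ u ⁆) σ∈Δ
    nonNeighbour≡v : ∀ {w} → w ∉ σ → ¬ Adj G u w → w ≡ v
    nonNeighbour≡v {w} w∉σ u≁w =
      decidable-stable (w ≟ v) (λ w≢v → u≁w (u-dominates w (x∉p∪⁅y⁆⁺ w∉σ w≢v)))
    meets : EveryDisconnectedPairMeets G (σ - u) v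
    meets a b (a≢b , a∉σ-u , b∉σ-u , a≁b) with a ≟ u | b ≟ u
    ... | yes refl | yes refl = ⊥-elim (a≢b refl)
    ... | yes refl | no b≢u   = inj₂ (nonNeighbour≡v (x∉p-y⇒x∉p b∉σ-u b≢u) a≁b)
    ... | no a≢u   | yes refl = inj₁ (nonNeighbour≡v (x∉p-y⇒x∉p a∉σ-u a≢u) (a≁b ∘ Graph.sym G))
    ... | no a≢u   | no b≢u   =
      Equivalence.to (inC⇔everyDisconnectedPairMeets v σ∈Δ) σ∈C a b
        (a≢b , x∉p-y⇒x∉p a∉σ-u a≢u , x∉p-y⇒x∉p b∉σ-u b≢u , a≁b)

proposition3p2 : ∀ {n} (G : Graph n) (u v : Fin n) → u ≢ v →
    ∀ (σ : Subset n) → InΔ2t G σ →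
      ((InC G v σ ⇔ (¬ InΔ2t G (σ ∪ ⁅ v ⁆)))
       × (InC G v σ ⇔ (∀ a b → DisconnectedPairOutside G σ a b → a ≡ v ⊎ b ≡ v)))
      × (InC G v σ → InΔ2t G (σ ∪ ⁅ u ⁆) → InC G v (σ ∪ ⁅ u ⁆))
      × (InC G v σ → (∀ w → w ∉ σ ∪ ⁅ v ⁆ → Adj G u w) → InC G v (σ - u))
proposition3p2 G u v _ σ σ∈Δ =
  (inC⇔ G v σ∈Δ , inC⇔everyDisconnectedPairMeets G v σ∈Δ) ,
  inC-upClosed G v (p⊆p∪q ⁅ u ⁆) σ∈Δ ,
  (λ σ∈C u-dominates → inC-minus G u-dominates σ∈Δ σ∈C)
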